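{- If a hypergraph $H$ is degenerate, then so is its suspension $S(H)$.
   Context: A hypergraph $G=(V,E)$ has a finite vertex set and edge set $E\subseteq 2^V$ (edges may have different sizes); $R(G)=\{|F|\colon F\in E\}$. For $G$ on $n$ vertices, $h_n(G)=\sum_{F\in E(G)}1/\binom{n}{|F|}$. $H\subseteq G$ if there is an injective $f\colon V(H)\to V(G)$ with $f(F)\in E(G)$ for all $F\in E(H)$. $\pi_n(H)=\max\{h_n(G)\colon v(G)=n,\ R(G)\subseteq R(H),\ H\not\subseteq G\}$, $\pi(H)=\lim_{n\to\infty}\pi_n(H)$; $H$ is degenerate if $\pi(H)=|R(H)|-1$. The suspension $S(H)$ has vertex set $V(H)\cup\{\ast\}$ ($\ast$ a new vertex) and edge set $\{F\cup\{\ast\}\colon F\in E(H)\}$. -}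

module Defs where

open import Data.Nat using (ℕ; zero; suc; _≤_)
open import Data.Nat.Combinatorics using (_C_)
open import Data.Bool using (Bool; true; false; _∧_; if_then_else_)
open import Data.Fin using (Fin; _≟_)
open import Data.Fin.Subset using (Subset; inside; outside; ∣_∣)
open import Data.Vec using (Vec; []; _∷_; lookup; tabulate)
open import Data.List using (List; []; _∷_; _++_; map; allFin; foldr; length; filterᵇ; upTo)
open import Data.Bool.ListAction using (any)
open import Data.Integer using (+_)
open import Data.Rational using (ℚ; 0ℚ; _+_; _-_; _/_; _<_; _≤_) renaming (∣_∣ to absℚ)
open import Data.Product using (Σ; _×_; ∃)
open import Function.Definitions using (Injective)
open import Relation.Binary.PropositionalEquality using (_≡_)
open import Relation.Nullary.Decidable using (⌊_⌋)

record Hypergraph : Set where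
  constructor hg
  field
    v    : ℕ
    edge : Subset v → Bool
open Hypergraph public

allSubsets : (n : ℕ) → List (Subset n)
allSubsets zero    = [] ∷ []
allSubsets (suc n) = map (inside ∷_) (allSubsets n) ++ map (outside ∷_) (allSubsets n)

edges : (G : Hypergraph) → List (Subset (v G))
edges G = filterᵇ (edge G) (allSubsets (v G))

-- Membership of a size in R(G) = {|F| : F ∈ E(G)} (as a Boolean).
hasSize : Hypergraph → ℕ → Bool
hasSize G j = any (λ F → ⌊ Data.Nat._≟_ ∣ F ∣ j ⌋) (edges G)

_⊆R_ : Hypergraph → Hypergraph → Set
G ⊆R H = (F : Subset (v G)) → edge G F ≡ true → hasSize H ∣ F ∣ ≡ true

-- |R(H)|: sizes of subsets of Fin v lie in 0..v.
sizeR : Hypergraph → ℕ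
sizeR H = length (filterᵇ (hasSize H) (upTo (suc (v H))))

image : {k n : ℕ} → (Fin k → Fin n) → Subset k → Subset n
image {k} f F = tabulate (λ j → any (λ i → lookup F i ∧ ⌊ f i ≟ j ⌋) (allFin k))

_⊑_ : Hypergraph → Hypergraph → Set
H ⊑ G = Σ (Fin (v H) → Fin (v G)) λ f → Injective _≡_ _≡_ f ×
          ((F : Subset (v H)) → edge H F ≡ true → edge G (image f F) ≡ true)

-- 1 / m as a rational (only used with m = binom(n,|F|) ≥ 1).
inv : ℕ → ℚ
inv zero    = 0ℚ
inv (suc m) = + 1 / suc m

sumℚ : List ℚ → ℚ
sumℚ = foldr _+_ 0ℚ

h : Hypergraph → ℚ
h G = sumℚ (map (λ F → inv (v G C ∣ F ∣)) (edges G))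

Admissible : Hypergraph → ℕ → Hypergraph → Set
Admissible H n G = (v G ≡ n) × (G ⊆R H) × ((H ⊑ G) → Data.Empty.⊥)
  where import Data.Empty

IsPi : Hypergraph → ℕ → ℚ → Set
IsPi H n q = (Σ Hypergraph λ G → Admissible H n G × h G ≡ q) ×
             ((G : Hypergraph) → Admissible H n G → h G Data.Rational.≤ q)

-- π(H) = lim π_n(H) = |R(H)| - 1, i.e. π_n(H) → |R(H)| - 1.
Degenerate : Hypergraph → Set
Degenerate H = (ε : ℚ) → 0ℚ < ε → Σ ℕ λ N → (n : ℕ) → N Data.Nat.≤ n →
               (q : ℚ) → IsPi H n q → absℚ (q - ((+ sizeR H / 1) - (+ 1 / 1))) < ε

-- Suspension: vertex set Fin (suc v), the new vertex ∗ being index zero;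
-- edges are exactly {∗} ∪ F for F ∈ E(H).
S : Hypergraph → Hypergraph
S H = hg (suc (v H)) e
  where
  e : Subset (suc (v H)) → Bool
  e (true  ∷ F) = edge H F
  e (false ∷ F) = false

-- Put t = |R(H)| - 1 = |R(S H)| - 1.  Lower bound: for n > v(H), the family of all subsets
-- of [n] whose sizes lie in R(S H), except the size of one edge {∗} ∪ E₀ of S H, contains no
-- copy of S H (an injection preserves sizes), and each complete level contributes exactly 1
-- to h_n; hence π_n(S H) ≥ t.  Upper bound: if G on m + 1 vertices contains no S H, every
-- link G_x = {F : F ∪ {x} ∈ G} is an H-free hypergraph on m vertices with sizes in R(H), and
-- double counting with |F| / C(m, |F| - 1) = (m + 1) / C(m + 1, |F|) gives
-- Σ_x h(G_x) = (m + 1) h(G); hence π_{m+1}(S H) ≤ π_m(H) → t.  Constructively π_m(H) exists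
-- only up to double negation (a maximum over finitely many hypergraphs whose admissibility is
-- not decided), which suffices since the target inequality between rationals is decidable.
-- If H has no edges, S H embeds into every large hypergraph and the claim is vacuous.

module Submission where

open import Defs

open import Algebra.Bundles using (CommutativeMonoid)
import Algebra.Properties.CommutativeSemigroup as CommutativeSemigroupProperties
import Algebra.Properties.Group as GroupProperties
open import Data.Bool using (Bool; true; false; _∧_; _∨_; not; T; T?)
open import Data.Bool.ListAction using (any; or)
open import Data.Bool.Properties using (T-≡; ⇔→≡)
open import Data.Empty using (⊥; ⊥-elim)
open import Data.Fin as Fin using (Fin; punchIn; punchOut)
import Data.Fin.Properties as FinP
open import Data.Fin.Subset using (Subset; inside; outside; ∣_∣)
open import Data.Fin.Subset.Properties using (∣p∣≤n)
open import Data.Integer as ℤ using (+_)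
import Data.Integer.Properties as ℤP
open import Data.List as List using (List; []; _∷_; _++_; map; allFin; filterᵇ; length; upTo)
import Data.List.Properties as ListP
open import Data.List.Membership.Propositional using (_∈_; lose; find)
open import Data.List.Membership.Propositional.Properties
  using (∈-filter⁺; ∈-filter⁻; ∈-map⁺; ∈-++⁺ˡ; ∈-++⁺ʳ; ∈-allFin; ∈-cartesianProductWith⁺)
import Data.List.Relation.Unary.All as All
open import Data.List.Relation.Unary.Any using (here; there)
open import Data.List.Relation.Unary.Any.Properties using (any⁺; any⁻)
open import Data.Nat as ℕ using (ℕ; zero; suc; z≤n; s≤s; _≡ᵇ_)
open import Data.Nat.Combinatorics using (_C_; nCk+nC[k+1]≡[n+1]C[k+1]; nC1≡n; k>n⇒nCk≡0)
import Data.Nat.Properties as ℕP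
open import Data.Nat.Coprimality using (1-coprimeTo) renaming (sym to Coprime-sym)
open import Data.Product using (Σ; ∃; _×_; _,_; proj₁; proj₂)
open import Data.Sum using (_⊎_; inj₁; inj₂)
open import Data.Rational as ℚ using (ℚ; _/_; 0ℚ; 1ℚ; fromℚᵘ; ↥_)
import Data.Rational.Properties as ℚP
open import Data.Rational.Unnormalised as ℚᵘ using (mkℚᵘ; *≡*)
import Data.Rational.Unnormalised.Properties as ℚᵘP
open import Data.Vec using (Vec; []; _∷_; lookup; insertAt)
import Data.Vec.Properties as VecP
open import Function using (_∘_; case_of_; Equivalence; mk⇔)
open import Function.Definitions using (Injective)
open import Relation.Binary.PropositionalEquality
open import Relation.Nullary using (¬_; Dec; yes; no; ¬¬-map; ¬¬-excluded-middle)
open import Relation.Nullary.Decidable using (⌊_⌋; isYes≗does; ⌊⌋-map′; toWitness; dec-true; decidable-stable)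

private
  variable
    A B : Set

fromℕ : ℕ → ℚ
fromℕ k = + k / 1

private
  fromℚᵘ-homo-+ : ∀ p q → fromℚᵘ (p ℚᵘ.+ q) ≡ fromℚᵘ p ℚ.+ fromℚᵘ q
  fromℚᵘ-homo-+ p q = ℚP.toℚᵘ-injective (ℚᵘP.≃-trans (ℚP.toℚᵘ-fromℚᵘ (p ℚᵘ.+ q))
    (ℚᵘP.≃-sym (ℚᵘP.≃-trans (ℚP.toℚᵘ-homo-+ (fromℚᵘ p) (fromℚᵘ q))
      (ℚᵘP.+-cong (ℚP.toℚᵘ-fromℚᵘ p) (ℚP.toℚᵘ-fromℚᵘ q)))))

  fromℚᵘ-homo-* : ∀ p q → fromℚᵘ (p ℚᵘ.* q) ≡ fromℚᵘ p ℚ.* fromℚᵘ q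
  fromℚᵘ-homo-* p q = ℚP.toℚᵘ-injective (ℚᵘP.≃-trans (ℚP.toℚᵘ-fromℚᵘ (p ℚᵘ.* q))
    (ℚᵘP.≃-sym (ℚᵘP.≃-trans (ℚP.toℚᵘ-homo-* (fromℚᵘ p) (fromℚᵘ q))
      (ℚᵘP.*-cong (ℚP.toℚᵘ-fromℚᵘ p) (ℚP.toℚᵘ-fromℚᵘ q)))))

fromℕ-+ : ∀ a b → fromℕ (a ℕ.+ b) ≡ fromℕ a ℚ.+ fromℕ b
fromℕ-+ a b = trans (cong (λ z → fromℚᵘ (mkℚᵘ z 0)) numerator)
  (fromℚᵘ-homo-+ (mkℚᵘ (+ a) 0) (mkℚᵘ (+ b) 0))
  where
  numerator : + (a ℕ.+ b) ≡ + a ℤ.* + 1 ℤ.+ + b ℤ.* + 1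
  numerator = trans (ℤP.pos-+ a b) (sym (cong₂ ℤ._+_ (ℤP.*-identityʳ (+ a)) (ℤP.*-identityʳ (+ b))))

fromℕ-injective : ∀ {a b} → fromℕ a ≡ fromℕ b → a ≡ b
fromℕ-injective {a} {b} eq = ℤP.+-injective (cong ↥_ (trans (sym (reduced a)) (trans eq (reduced b))))
  where
  reduced : ∀ a → fromℕ a ≡ ℚ.mkℚ (+ a) 0 (Coprime-sym (1-coprimeTo a))
  reduced a = ℚP.normalize-coprime (Coprime-sym (1-coprimeTo a))

fromℕ-*-inv : ∀ x a → fromℕ x ℚ.* inv (suc a) ≡ fromℚᵘ (mkℚᵘ (+ x) a)
fromℕ-*-inv x a = trans (sym (fromℚᵘ-homo-* (mkℚᵘ (+ x) 0) (mkℚᵘ (+ 1) a)))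
  (cong fromℚᵘ (cong₂ mkℚᵘ (ℤP.*-identityʳ (+ x)) (ℕP.+-identityʳ a)))

fromℕ-*-inv-cross : ∀ x y a b → x ℕ.* suc b ≡ y ℕ.* suc a →
                    fromℕ x ℚ.* inv (suc a) ≡ fromℕ y ℚ.* inv (suc b)
fromℕ-*-inv-cross x y a b eq = begin
  fromℕ x ℚ.* inv (suc a)  ≡⟨ fromℕ-*-inv x a ⟩
  fromℚᵘ (mkℚᵘ (+ x) a)    ≡⟨ ℚP.fromℚᵘ-cong {mkℚᵘ (+ x) a} {mkℚᵘ (+ y) b} (*≡* cross) ⟩
  fromℚᵘ (mkℚᵘ (+ y) b)    ≡⟨ fromℕ-*-inv y b ⟨
  fromℕ y ℚ.* inv (suc b)  ∎
  where
  open ≡-Reasoning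
  cross : + x ℤ.* + suc b ≡ + y ℤ.* + suc a
  cross = trans (sym (ℤP.pos-* x (suc b))) (trans (cong +_ eq) (ℤP.pos-* y (suc a)))

fromℕ-*-inv-self : ∀ a → fromℕ (suc a) ℚ.* inv (suc a) ≡ 1ℚ
fromℕ-*-inv-self a = fromℕ-*-inv-cross (suc a) 1 a 0 (ℕP.*-comm (suc a) 1)

∑ : List A → (A → ℚ) → ℚ
∑ xs f = sumℚ (map f xs)

∑-++ : ∀ (xs ys : List A) (f : A → ℚ) → ∑ (xs ++ ys) f ≡ ∑ xs f ℚ.+ ∑ ys f
∑-++ []       ys f = sym (ℚP.+-identityˡ _)
∑-++ (x ∷ xs) ys f = trans (cong (f x ℚ.+_) (∑-++ xs ys f)) (sym (ℚP.+-assoc (f x) _ _))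

∑-map : ∀ (g : A → B) xs (f : B → ℚ) → ∑ (map g xs) f ≡ ∑ xs (f ∘ g)
∑-map g xs f = cong sumℚ (sym (ListP.map-∘ xs))

∑-cong : ∀ (xs : List A) {f g : A → ℚ} → (∀ x → f x ≡ g x) → ∑ xs f ≡ ∑ xs g
∑-cong xs f≗g = cong sumℚ (ListP.map-cong f≗g xs)

∑-zero : ∀ (xs : List A) → ∑ xs (λ _ → 0ℚ) ≡ 0ℚ
∑-zero []       = refl
∑-zero (x ∷ xs) = trans (ℚP.+-identityˡ _) (∑-zero xs)

∑-+ : ∀ (xs : List A) (f g : A → ℚ) → ∑ xs (λ x → f x ℚ.+ g x) ≡ ∑ xs f ℚ.+ ∑ xs g
∑-+ []       f g = refl
∑-+ (x ∷ xs) f g = trans (cong (f x ℚ.+ g x ℚ.+_) (∑-+ xs f g)) (interchange (f x) (g x) _ _)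
  where
  open CommutativeSemigroupProperties
    (CommutativeMonoid.commutativeSemigroup ℚP.+-0-commutativeMonoid)

∑-*ˡ : ∀ c (xs : List A) (f : A → ℚ) → c ℚ.* ∑ xs f ≡ ∑ xs (λ x → c ℚ.* f x)
∑-*ˡ c []       f = ℚP.*-zeroʳ c
∑-*ˡ c (x ∷ xs) f = trans (ℚP.*-distribˡ-+ c (f x) _) (cong (c ℚ.* f x ℚ.+_) (∑-*ˡ c xs f))

∑-swap : ∀ (xs : List A) (ys : List B) (f : A → B → ℚ) →
         ∑ xs (λ x → ∑ ys (f x)) ≡ ∑ ys (λ y → ∑ xs (λ x → f x y))
∑-swap []       ys f = sym (∑-zero ys)
∑-swap (x ∷ xs) ys f = trans (cong (∑ ys (f x) ℚ.+_) (∑-swap xs ys f))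
  (sym (∑-+ ys (f x) (λ y → ∑ xs (λ x → f x y))))

∑-mono-≤ : ∀ (xs : List A) {f g : A → ℚ} → (∀ x → f x ℚ.≤ g x) → ∑ xs f ℚ.≤ ∑ xs g
∑-mono-≤ []       f≤g = ℚP.≤-refl
∑-mono-≤ (x ∷ xs) f≤g = ℚP.+-mono-≤ (f≤g x) (∑-mono-≤ xs f≤g)

∑-const : ∀ (xs : List A) c → ∑ xs (λ _ → c) ≡ fromℕ (length xs) ℚ.* c
∑-const []       c = sym (ℚP.*-zeroˡ c)
∑-const (x ∷ xs) c = begin
  c ℚ.+ ∑ xs (λ _ → c)                     ≡⟨ cong₂ ℚ._+_ (sym (ℚP.*-identityˡ c)) (∑-const xs c) ⟩
  1ℚ ℚ.* c ℚ.+ fromℕ (length xs) ℚ.* c     ≡⟨ ℚP.*-distribʳ-+ c 1ℚ (fromℕ (length xs)) ⟨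
  (1ℚ ℚ.+ fromℕ (length xs)) ℚ.* c         ≡⟨ cong (ℚ._* c) (fromℕ-+ 1 (length xs)) ⟨
  fromℕ (suc (length xs)) ℚ.* c            ∎
  where open ≡-Reasoning

∑-allFin-suc : ∀ {n} (f : Fin (suc n) → ℚ) → ∑ (allFin (suc n)) f ≡ f Fin.zero ℚ.+ ∑ (allFin n) (f ∘ Fin.suc)
∑-allFin-suc f = cong (λ xs → f Fin.zero ℚ.+ sumℚ xs)
  (trans (ListP.map-tabulate Fin.suc f) (sym (ListP.map-tabulate (λ i → i) (f ∘ Fin.suc))))

∑-upTo-suc : ∀ n (u : ℕ → ℚ) → ∑ (upTo (suc n)) u ≡ u 0 ℚ.+ ∑ (upTo n) (u ∘ suc)
∑-upTo-suc n u = cong (λ xs → u 0 ℚ.+ sumℚ xs)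
  (trans (ListP.map-applyUpTo suc u n) (sym (ListP.map-applyUpTo (λ i → i) (u ∘ suc) n)))

∑-upTo-cong : ∀ n {u w : ℕ → ℚ} → (∀ j → j ℕ.< n → u j ≡ w j) → ∑ (upTo n) u ≡ ∑ (upTo n) w
∑-upTo-cong zero    u≗w = refl
∑-upTo-cong (suc n) {u} {w} u≗w = begin
  ∑ (upTo (suc n)) u            ≡⟨ ∑-upTo-suc n u ⟩
  u 0 ℚ.+ ∑ (upTo n) (u ∘ suc)  ≡⟨ cong₂ ℚ._+_ (u≗w 0 (s≤s z≤n)) (∑-upTo-cong n (λ j j<n → u≗w (suc j) (s≤s j<n))) ⟩
  w 0 ℚ.+ ∑ (upTo n) (w ∘ suc)  ≡⟨ ∑-upTo-suc n w ⟨
  ∑ (upTo (suc n)) w            ∎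
  where open ≡-Reasoning

∑-upTo-vanishing : ∀ {m n} (u : ℕ → ℚ) → m ℕ.≤ n → (∀ j → m ℕ.≤ j → u j ≡ 0ℚ) →
                   ∑ (upTo n) u ≡ ∑ (upTo m) u
∑-upTo-vanishing {n = n} u z≤n       u≡0 = trans (∑-cong (upTo n) (λ j → u≡0 j z≤n)) (∑-zero (upTo n))
∑-upTo-vanishing {suc m} {suc n} u (s≤s m≤n) u≡0 = begin
  ∑ (upTo (suc n)) u            ≡⟨ ∑-upTo-suc n u ⟩
  u 0 ℚ.+ ∑ (upTo n) (u ∘ suc)  ≡⟨ cong (u 0 ℚ.+_) (∑-upTo-vanishing (u ∘ suc) m≤n (λ j m≤j → u≡0 (suc j) (s≤s m≤j))) ⟩
  u 0 ℚ.+ ∑ (upTo m) (u ∘ suc)  ≡⟨ ∑-upTo-suc m u ⟨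
  ∑ (upTo (suc m)) u            ∎
  where open ≡-Reasoning

_when_ : ℚ → Bool → ℚ
c when true  = c
c when false = 0ℚ

𝟙 : Bool → ℚ
𝟙 b = 1ℚ when b

when≡*𝟙 : ∀ c b → c when b ≡ c ℚ.* 𝟙 b
when≡*𝟙 c true  = sym (ℚP.*-identityʳ c)
when≡*𝟙 c false = sym (ℚP.*-zeroʳ c)

*-when : ∀ c d b → c ℚ.* (d when b) ≡ (c ℚ.* d) when b
*-when c d true  = refl
*-when c d false = ℚP.*-zeroʳ c

𝟙-split : ∀ a b → 𝟙 a ≡ 𝟙 (a ∧ not b) ℚ.+ 𝟙 a when b
𝟙-split true  true  = sym (ℚP.+-identityˡ 1ℚ)
𝟙-split true  false = sym (ℚP.+-identityʳ 1ℚ)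
𝟙-split false true  = sym (ℚP.+-identityˡ 0ℚ)
𝟙-split false false = sym (ℚP.+-identityˡ 0ℚ)

𝟙-∨-disjoint : ∀ a b → (a ≡ true → b ≡ true → ⊥) → 𝟙 (a ∨ b) ≡ 𝟙 a ℚ.+ 𝟙 b
𝟙-∨-disjoint true  true  a#b = ⊥-elim (a#b refl refl)
𝟙-∨-disjoint true  false a#b = sym (ℚP.+-identityʳ 1ℚ)
𝟙-∨-disjoint false b     a#b = sym (ℚP.+-identityˡ (𝟙 b))

∑-filterᵇ : ∀ (p : A → Bool) xs (f : A → ℚ) → ∑ (filterᵇ p xs) f ≡ ∑ xs (λ x → f x when p x)
∑-filterᵇ p []       f = refl
∑-filterᵇ p (x ∷ xs) f with p x
... | true  = cong (f x ℚ.+_) (∑-filterᵇ p xs f)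
... | false = trans (∑-filterᵇ p xs f) (sym (ℚP.+-identityˡ _))

fromℕ-length-filterᵇ : ∀ (p : A → Bool) xs → fromℕ (length (filterᵇ p xs)) ≡ ∑ xs (𝟙 ∘ p)
fromℕ-length-filterᵇ p []       = refl
fromℕ-length-filterᵇ p (x ∷ xs) with p x
... | true  = trans (fromℕ-+ 1 (length (filterᵇ p xs))) (cong (1ℚ ℚ.+_) (fromℕ-length-filterᵇ p xs))
... | false = trans (fromℕ-length-filterᵇ p xs) (sym (ℚP.+-identityˡ _))

∑-upTo-δ : ∀ {a n} → a ℕ.< n → (u : ℕ → ℚ) → ∑ (upTo n) (λ j → u j when (a ≡ᵇ j)) ≡ u a
∑-upTo-δ {zero} {suc n} _ u = begin
  ∑ (upTo (suc n)) (λ j → u j when (0 ≡ᵇ j))  ≡⟨ ∑-upTo-suc n (λ j → u j when (0 ≡ᵇ j)) ⟩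
  u 0 ℚ.+ ∑ (upTo n) (λ _ → 0ℚ)              ≡⟨ cong (u 0 ℚ.+_) (∑-zero (upTo n)) ⟩
  u 0 ℚ.+ 0ℚ                                 ≡⟨ ℚP.+-identityʳ (u 0) ⟩
  u 0                                        ∎
  where open ≡-Reasoning
∑-upTo-δ {suc a} {suc n} (s≤s a<n) u =
  trans (∑-upTo-suc n (λ j → u j when (suc a ≡ᵇ j))) (trans (ℚP.+-identityˡ _) (∑-upTo-δ a<n (u ∘ suc)))

∑-allFin-δ : ∀ {n} (x : Fin n) → ∑ (allFin n) (λ j → 𝟙 ⌊ x Fin.≟ j ⌋) ≡ 1ℚ
∑-allFin-δ {suc n} Fin.zero = begin
  ∑ (allFin (suc n)) (λ j → 𝟙 ⌊ Fin.zero Fin.≟ j ⌋)  ≡⟨ ∑-allFin-suc {n} (λ j → 𝟙 ⌊ Fin.zero Fin.≟ j ⌋) ⟩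
  1ℚ ℚ.+ ∑ (allFin n) (λ _ → 0ℚ)                     ≡⟨ cong (1ℚ ℚ.+_) (∑-zero (allFin n)) ⟩
  1ℚ ℚ.+ 0ℚ                                          ≡⟨ ℚP.+-identityʳ 1ℚ ⟩
  1ℚ                                                 ∎
  where open ≡-Reasoning
∑-allFin-δ {suc n} (Fin.suc x) = begin
  ∑ (allFin (suc n)) (λ j → 𝟙 ⌊ Fin.suc x Fin.≟ j ⌋)          ≡⟨ ∑-allFin-suc {n} (λ j → 𝟙 ⌊ Fin.suc x Fin.≟ j ⌋) ⟩
  0ℚ ℚ.+ ∑ (allFin n) (λ j → 𝟙 ⌊ Fin.suc x Fin.≟ Fin.suc j ⌋)  ≡⟨ ℚP.+-identityˡ _ ⟩
  ∑ (allFin n) (λ j → 𝟙 ⌊ Fin.suc x Fin.≟ Fin.suc j ⌋)         ≡⟨ ∑-cong (allFin n) (λ j → cong 𝟙 (⌊⌋-map′ _ _ (x Fin.≟ j))) ⟩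
  ∑ (allFin n) (λ j → 𝟙 ⌊ x Fin.≟ j ⌋)                         ≡⟨ ∑-allFin-δ x ⟩
  1ℚ                                                           ∎
  where open ≡-Reasoning

∧≡true : ∀ {a b} → a ∧ b ≡ true → a ≡ true × b ≡ true
∧≡true {true} {true} _ = refl , refl

≡ᵇ-refl : ∀ n → (n ≡ᵇ n) ≡ true
≡ᵇ-refl n = Equivalence.to T-≡ (ℕP.≡⇒≡ᵇ n n refl)

⌊≟⌋-refl : ∀ {n} (i : Fin n) → ⌊ i Fin.≟ i ⌋ ≡ true
⌊≟⌋-refl i = trans (isYes≗does (i Fin.≟ i)) (dec-true (i Fin.≟ i) refl)

⌊⌋≡true⇒ : ∀ {P : Set} (P? : Dec P) → ⌊ P? ⌋ ≡ true → P
⌊⌋≡true⇒ P? eq = toWitness (Equivalence.from T-≡ eq)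

any-map : ∀ (p : B → Bool) (f : A → B) xs → any p (map f xs) ≡ any (p ∘ f) xs
any-map p f xs = cong or (sym (ListP.map-∘ xs))

any-false : ∀ (xs : List A) → any (λ _ → false) xs ≡ false
any-false []       = refl
any-false (x ∷ xs) = any-false xs

any-allFin-suc : ∀ {n} (p : Fin (suc n) → Bool) → any p (allFin (suc n)) ≡ p Fin.zero ∨ any (p ∘ Fin.suc) (allFin n)
any-allFin-suc p = cong (λ xs → p Fin.zero ∨ or xs)
  (trans (ListP.map-tabulate Fin.suc p) (sym (ListP.map-tabulate (λ i → i) (p ∘ Fin.suc))))

any-∈⁺ : ∀ (p : A → Bool) {x xs} → x ∈ xs → p x ≡ true → any p xs ≡ true
any-∈⁺ p x∈xs px = Equivalence.to T-≡ (any⁺ p (lose {P = T ∘ p} x∈xs (Equivalence.from T-≡ px)))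

any-∈⁻ : ∀ (p : A → Bool) xs → any p xs ≡ true → ∃ λ x → x ∈ xs × p x ≡ true
any-∈⁻ p xs eq with find (any⁻ p xs (Equivalence.from T-≡ eq))
... | x , x∈xs , px = x , x∈xs , Equivalence.to T-≡ px

filterᵇ-map : ∀ (p : B → Bool) (f : A → B) xs → filterᵇ p (map f xs) ≡ map f (filterᵇ (p ∘ f) xs)
filterᵇ-map p f []       = refl
filterᵇ-map p f (x ∷ xs) with p (f x)
... | true  = cong (f x ∷_) (filterᵇ-map p f xs)
... | false = filterᵇ-map p f xs

∈-allSubsets : ∀ {n} (F : Subset n) → F ∈ allSubsets n
∈-allSubsets []                = here refl
∈-allSubsets {suc n} (true ∷ F)  = ∈-++⁺ˡ (∈-map⁺ (inside ∷_) (∈-allSubsets F))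
∈-allSubsets {suc n} (false ∷ F) =
  ∈-++⁺ʳ (map (inside ∷_) (allSubsets n)) (∈-map⁺ (outside ∷_) (∈-allSubsets F))

≗-lookup⇒≡ : ∀ {n} {u w : Vec A n} → (∀ j → lookup u j ≡ lookup w j) → u ≡ w
≗-lookup⇒≡ {u = u} {w} eq =
  trans (sym (VecP.tabulate∘lookup u)) (trans (VecP.tabulate-cong eq) (VecP.tabulate∘lookup w))

∣insertAt∣ : ∀ {m} (F : Subset m) x → ∣ insertAt F x true ∣ ≡ suc ∣ F ∣
∣insertAt∣ F           Fin.zero    = refl
∣insertAt∣ (true ∷ F)  (Fin.suc y) = cong suc (∣insertAt∣ F y)
∣insertAt∣ (false ∷ F) (Fin.suc y) = ∣insertAt∣ F y

fromℕ-∣∷∣ : ∀ {n} b (F : Subset n) → fromℕ ∣ b ∷ F ∣ ≡ 𝟙 b ℚ.+ fromℕ ∣ F ∣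
fromℕ-∣∷∣ true  F = fromℕ-+ 1 ∣ F ∣
fromℕ-∣∷∣ false F = sym (ℚP.+-identityˡ _)

fromℕ-∣∣ : ∀ {n} (F : Subset n) → fromℕ ∣ F ∣ ≡ ∑ (allFin n) (𝟙 ∘ lookup F)
fromℕ-∣∣ []      = refl
fromℕ-∣∣ (b ∷ F) = trans (fromℕ-∣∷∣ b F)
  (trans (cong (𝟙 b ℚ.+_) (fromℕ-∣∣ F)) (sym (∑-allFin-suc (𝟙 ∘ lookup (b ∷ F)))))

∑-allSubsets-suc : ∀ m (f : Subset (suc m) → ℚ) →
  ∑ (allSubsets (suc m)) f ≡ ∑ (allSubsets m) (f ∘ (inside ∷_)) ℚ.+ ∑ (allSubsets m) (f ∘ (outside ∷_))
∑-allSubsets-suc m f = trans (∑-++ (map (inside ∷_) (allSubsets m)) _ f)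
  (cong₂ ℚ._+_ (∑-map (inside ∷_) (allSubsets m) f) (∑-map (outside ∷_) (allSubsets m) f))

∑-containing : ∀ m (x : Fin (suc m)) (g : Subset (suc m) → ℚ) →
  ∑ (allSubsets (suc m)) (λ F → g F when lookup F x) ≡ ∑ (allSubsets m) (λ F → g (insertAt F x true))
∑-containing m Fin.zero g = trans (∑-allSubsets-suc m (λ F → g F when lookup F Fin.zero))
  (trans (cong (∑ (allSubsets m) (λ F → g (insertAt F Fin.zero true)) ℚ.+_) (∑-zero (allSubsets m))) (ℚP.+-identityʳ _))
∑-containing (suc m) (Fin.suc y) g = trans (∑-allSubsets-suc (suc m) (λ F → g F when lookup F (Fin.suc y)))
  (trans (cong₂ ℚ._+_ (∑-containing m y (g ∘ (true ∷_))) (∑-containing m y (g ∘ (false ∷_))))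
    (sym (∑-allSubsets-suc m (λ F → g (insertAt F (Fin.suc y) true)))))

∑-level : ∀ n j → ∑ (allSubsets n) (λ F → 𝟙 (∣ F ∣ ≡ᵇ j)) ≡ fromℕ (n C j)
∑-level zero    zero    = refl
∑-level zero    (suc j) = ℚP.+-identityʳ 0ℚ
∑-level (suc n) zero    = begin
  ∑ (allSubsets (suc n)) (λ F → 𝟙 (∣ F ∣ ≡ᵇ 0))
    ≡⟨ ∑-allSubsets-suc n (λ F → 𝟙 (∣ F ∣ ≡ᵇ 0)) ⟩
  ∑ 𝒮 (λ _ → 0ℚ) ℚ.+ ∑ 𝒮 (λ F → 𝟙 (∣ F ∣ ≡ᵇ 0))
    ≡⟨ cong (ℚ._+ ∑ 𝒮 (λ F → 𝟙 (∣ F ∣ ≡ᵇ 0))) (∑-zero 𝒮) ⟩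
  0ℚ ℚ.+ ∑ 𝒮 (λ F → 𝟙 (∣ F ∣ ≡ᵇ 0))
    ≡⟨ trans (ℚP.+-identityˡ _) (∑-level n zero) ⟩
  fromℕ 1
    ∎
  where
  open ≡-Reasoning
  𝒮 = allSubsets n
∑-level (suc n) (suc j) = begin
  ∑ (allSubsets (suc n)) (λ F → 𝟙 (∣ F ∣ ≡ᵇ suc j))
    ≡⟨ ∑-allSubsets-suc n (λ F → 𝟙 (∣ F ∣ ≡ᵇ suc j)) ⟩
  ∑ 𝒮 (λ F → 𝟙 (∣ F ∣ ≡ᵇ j)) ℚ.+ ∑ 𝒮 (λ F → 𝟙 (∣ F ∣ ≡ᵇ suc j))
    ≡⟨ cong₂ ℚ._+_ (∑-level n j) (∑-level n (suc j)) ⟩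
  fromℕ (n C j) ℚ.+ fromℕ (n C suc j)
    ≡⟨ fromℕ-+ (n C j) (n C suc j) ⟨
  fromℕ (n C j ℕ.+ n C suc j)
    ≡⟨ cong fromℕ (nCk+nC[k+1]≡[n+1]C[k+1] n j) ⟩
  fromℕ (suc n C suc j)
    ∎
  where
  open ≡-Reasoning
  𝒮 = allSubsets n

∑-by-size : ∀ n (u : ℕ → ℚ) → ∑ (allSubsets n) (u ∘ ∣_∣) ≡ ∑ (upTo (suc n)) (λ j → fromℕ (n C j) ℚ.* u j)
∑-by-size n u = begin
  ∑ 𝒮 (u ∘ ∣_∣)
    ≡⟨ ∑-cong 𝒮 (λ F → sym (∑-upTo-δ (s≤s (∣p∣≤n F)) u)) ⟩
  ∑ 𝒮 (λ F → ∑ ℐ (λ j → u j when (∣ F ∣ ≡ᵇ j)))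
    ≡⟨ ∑-swap 𝒮 ℐ (λ F j → u j when (∣ F ∣ ≡ᵇ j)) ⟩
  ∑ ℐ (λ j → ∑ 𝒮 (λ F → u j when (∣ F ∣ ≡ᵇ j)))
    ≡⟨ ∑-cong ℐ (λ j → ∑-cong 𝒮 (λ F → when≡*𝟙 (u j) (∣ F ∣ ≡ᵇ j))) ⟩
  ∑ ℐ (λ j → ∑ 𝒮 (λ F → u j ℚ.* 𝟙 (∣ F ∣ ≡ᵇ j)))
    ≡⟨ ∑-cong ℐ (λ j → ∑-*ˡ (u j) 𝒮 (λ F → 𝟙 (∣ F ∣ ≡ᵇ j))) ⟨
  ∑ ℐ (λ j → u j ℚ.* ∑ 𝒮 (λ F → 𝟙 (∣ F ∣ ≡ᵇ j)))
    ≡⟨ ∑-cong ℐ (λ j → trans (cong (u j ℚ.*_) (∑-level n j)) (ℚP.*-comm (u j) _)) ⟩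
  ∑ ℐ (λ j → fromℕ (n C j) ℚ.* u j)
    ∎
  where
  open ≡-Reasoning
  𝒮 = allSubsets n
  ℐ = upTo (suc n)

C-absorb : ∀ m j → suc j ℕ.* (suc m C suc j) ≡ suc m ℕ.* (m C j)
C-absorb zero zero = refl
C-absorb zero (suc j) = begin
  suc (suc j) ℕ.* (1 C suc (suc j))  ≡⟨ cong (suc (suc j) ℕ.*_) (k>n⇒nCk≡0 {1} {suc (suc j)} (s≤s (s≤s z≤n))) ⟩
  suc (suc j) ℕ.* 0                  ≡⟨ ℕP.*-zeroʳ (suc (suc j)) ⟩
  0                                  ≡⟨ cong (1 ℕ.*_) (k>n⇒nCk≡0 {0} {suc j} (s≤s z≤n)) ⟨
  1 ℕ.* (0 C suc j)                  ∎
  where open ≡-Reasoning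
C-absorb (suc m) zero = trans (ℕP.*-identityˡ _) (trans (nC1≡n (suc (suc m))) (sym (ℕP.*-identityʳ _)))
C-absorb (suc m) (suc j) = begin
  suc (suc j) ℕ.* (suc (suc m) C suc (suc j))
    ≡⟨ cong (suc (suc j) ℕ.*_) (nCk+nC[k+1]≡[n+1]C[k+1] (suc m) (suc j)) ⟨
  suc (suc j) ℕ.* (a ℕ.+ b)
    ≡⟨ ℕP.*-distribˡ-+ (suc (suc j)) a b ⟩
  (a ℕ.+ suc j ℕ.* a) ℕ.+ suc (suc j) ℕ.* b
    ≡⟨ ℕP.+-assoc a _ _ ⟩
  a ℕ.+ (suc j ℕ.* a ℕ.+ suc (suc j) ℕ.* b)
    ≡⟨ cong (a ℕ.+_) (cong₂ ℕ._+_ (C-absorb m j) (C-absorb m (suc j))) ⟩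
  a ℕ.+ (suc m ℕ.* (m C j) ℕ.+ suc m ℕ.* (m C suc j))
    ≡⟨ cong (a ℕ.+_) (ℕP.*-distribˡ-+ (suc m) (m C j) (m C suc j)) ⟨
  a ℕ.+ suc m ℕ.* (m C j ℕ.+ m C suc j)
    ≡⟨ cong (λ c → a ℕ.+ suc m ℕ.* c) (nCk+nC[k+1]≡[n+1]C[k+1] m j) ⟩
  suc (suc m) ℕ.* a
    ∎
  where
  open ≡-Reasoning
  a = suc m C suc j
  b = suc m C suc (suc j)

C-positive : ∀ {m j} → j ℕ.≤ m → ∃ λ a → m C j ≡ suc a
C-positive {m} {zero} _ = 0 , refl
C-positive {suc m} {suc j} (s≤s j≤m) with C-positive j≤m
... | a , eq = a ℕ.+ (m C suc j) , trans (sym (nCk+nC[k+1]≡[n+1]C[k+1] m j)) (cong (ℕ._+ (m C suc j)) eq)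

C-absorb-inv : ∀ {m j} → j ℕ.≤ m → fromℕ (suc j) ℚ.* inv (m C j) ≡ fromℕ (suc m) ℚ.* inv (suc m C suc j)
C-absorb-inv {m} {j} j≤m with m C j | suc m C suc j | C-absorb m j | C-positive j≤m | C-positive (s≤s j≤m)
... | .(suc a) | .(suc b) | absorb | a , refl | b , refl = fromℕ-*-inv-cross (suc j) (suc m) a b absorb

fromℕ-C-*-inv-C : ∀ {n j} → j ℕ.≤ n → fromℕ (n C j) ℚ.* inv (n C j) ≡ 1ℚ
fromℕ-C-*-inv-C j≤n with C-positive j≤n
... | a , eq rewrite eq = fromℕ-*-inv-self a

∈-edges : ∀ G {F} → edge G F ≡ true → F ∈ edges G
∈-edges G {F} e = ∈-filter⁺ (T? ∘ edge G) (∈-allSubsets F) (Equivalence.from T-≡ e)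

hasSize≡any : ∀ G j → hasSize G j ≡ any (λ F → ∣ F ∣ ≡ᵇ j) (edges G)
hasSize≡any G j = cong or (ListP.map-cong (λ F → isYes≗does (∣ F ∣ ℕP.≟ j)) (edges G))

hasSize-edge : ∀ G {F} → edge G F ≡ true → hasSize G ∣ F ∣ ≡ true
hasSize-edge G {F} e = trans (hasSize≡any G ∣ F ∣) (any-∈⁺ _ (∈-edges G e) (≡ᵇ-refl ∣ F ∣))

hasSize-≤ : ∀ G {j} → hasSize G j ≡ true → j ℕ.≤ v G
hasSize-≤ G {j} e with any-∈⁻ _ (edges G) (trans (sym (hasSize≡any G j)) e)
... | F , _ , ∣F∣≡ᵇj = subst (ℕ._≤ v G) (ℕP.≡ᵇ⇒≡ ∣ F ∣ j (Equivalence.from T-≡ ∣F∣≡ᵇj)) (∣p∣≤n F)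

fromℕ-sizeR : ∀ G → fromℕ (sizeR G) ≡ ∑ (upTo (suc (v G))) (𝟙 ∘ hasSize G)
fromℕ-sizeR G = fromℕ-length-filterᵇ (hasSize G) (upTo (suc (v G)))

edges-S : ∀ H → edges (S H) ≡ map (inside ∷_) (edges H)
edges-S H = begin
  filterᵇ (edge (S H)) (map (inside ∷_) 𝒮 ++ map (outside ∷_) 𝒮)
    ≡⟨ ListP.filter-++ (T? ∘ edge (S H)) (map (inside ∷_) 𝒮) (map (outside ∷_) 𝒮) ⟩
  filterᵇ (edge (S H)) (map (inside ∷_) 𝒮) ++ filterᵇ (edge (S H)) (map (outside ∷_) 𝒮)
    ≡⟨ cong₂ _++_ (filterᵇ-map (edge (S H)) (inside ∷_) 𝒮) (filterᵇ-map (edge (S H)) (outside ∷_) 𝒮) ⟩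
  map (inside ∷_) (edges H) ++ map (outside ∷_) (filterᵇ (λ _ → false) 𝒮)
    ≡⟨ cong (λ es → map (inside ∷_) (edges H) ++ map (outside ∷_) es) (ListP.filter-none (T? ∘ λ _ → false) (All.universal (λ _ ()) 𝒮)) ⟩
  map (inside ∷_) (edges H) ++ []
    ≡⟨ ListP.++-identityʳ _ ⟩
  map (inside ∷_) (edges H) ∎
  where
  open ≡-Reasoning
  𝒮 = allSubsets (v H)

hasSize-S-suc : ∀ H j → hasSize (S H) (suc j) ≡ hasSize H j
hasSize-S-suc H j = begin
  hasSize (S H) (suc j)                                   ≡⟨ hasSize≡any (S H) (suc j) ⟩
  any (λ F → ∣ F ∣ ≡ᵇ suc j) (edges (S H))                ≡⟨ cong (any (λ F → ∣ F ∣ ≡ᵇ suc j)) (edges-S H) ⟩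
  any (λ F → ∣ F ∣ ≡ᵇ suc j) (map (inside ∷_) (edges H))  ≡⟨ any-map (λ F → ∣ F ∣ ≡ᵇ suc j) (inside ∷_) (edges H) ⟩
  any (λ F → ∣ F ∣ ≡ᵇ j) (edges H)                        ≡⟨ hasSize≡any H j ⟨
  hasSize H j                                             ∎
  where open ≡-Reasoning

hasSize-S-zero : ∀ H → hasSize (S H) 0 ≡ false
hasSize-S-zero H = trans (hasSize≡any (S H) 0) (trans (cong (any (λ F → ∣ F ∣ ≡ᵇ 0)) (edges-S H))
  (trans (any-map (λ F → ∣ F ∣ ≡ᵇ 0) (inside ∷_) (edges H)) (any-false (edges H))))

hasSize-S⇒positive : ∀ H {j} → hasSize (S H) j ≡ true → 0 ℕ.< j
hasSize-S⇒positive H {zero}  e with () ← trans (sym (hasSize-S-zero H)) e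
hasSize-S⇒positive H {suc j} e = s≤s z≤n

fromℕ-sizeR-S : ∀ H → fromℕ (sizeR (S H)) ≡ fromℕ (sizeR H)
fromℕ-sizeR-S H = begin
  fromℕ (sizeR (S H))                                               ≡⟨ fromℕ-sizeR (S H) ⟩
  ∑ (upTo (suc (suc (v H)))) (𝟙 ∘ hasSize (S H))                    ≡⟨ ∑-upTo-suc (suc (v H)) (𝟙 ∘ hasSize (S H)) ⟩
  𝟙 (hasSize (S H) 0) ℚ.+ ∑ (upTo (suc (v H))) (𝟙 ∘ hasSize (S H) ∘ suc)
    ≡⟨ cong₂ ℚ._+_ (cong 𝟙 (hasSize-S-zero H)) (∑-cong (upTo (suc (v H))) (cong 𝟙 ∘ hasSize-S-suc H)) ⟩
  0ℚ ℚ.+ ∑ (upTo (suc (v H))) (𝟙 ∘ hasSize H)                       ≡⟨ ℚP.+-identityˡ _ ⟩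
  ∑ (upTo (suc (v H))) (𝟙 ∘ hasSize H)                              ≡⟨ fromℕ-sizeR H ⟨
  fromℕ (sizeR H)                                                   ∎
  where open ≡-Reasoning

lookup-image : ∀ {k n} (f : Fin k → Fin n) F j →
               lookup (image f F) j ≡ any (λ i → lookup F i ∧ ⌊ f i Fin.≟ j ⌋) (allFin k)
lookup-image f F j = VecP.lookup∘tabulate _ j

image-∋⁺ : ∀ {k n} (f : Fin k → Fin n) F {i} → lookup F i ≡ true → lookup (image f F) (f i) ≡ true
image-∋⁺ f F {i} Fi = trans (lookup-image f F (f i))
  (any-∈⁺ (λ i′ → lookup F i′ ∧ ⌊ f i′ Fin.≟ f i ⌋) (∈-allFin i) (cong₂ _∧_ Fi (⌊≟⌋-refl (f i))))

image-∋⁻ : ∀ {k n} (f : Fin k → Fin n) F {j} → lookup (image f F) j ≡ true →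
           ∃ λ i → lookup F i ≡ true × f i ≡ j
image-∋⁻ {k} f F {j} e with any-∈⁻ _ (allFin k) (trans (sym (lookup-image f F j)) e)
... | i , _ , hit = i , proj₁ (∧≡true hit) , ⌊⌋≡true⇒ (f i Fin.≟ j) (proj₂ (∧≡true hit))

lookup-image-∷ : ∀ {k n} (f : Fin (suc k) → Fin n) b F j →
  lookup (image f (b ∷ F)) j ≡ (b ∧ ⌊ f Fin.zero Fin.≟ j ⌋) ∨ lookup (image (f ∘ Fin.suc) F) j
lookup-image-∷ f b F j = trans (lookup-image f (b ∷ F) j)
  (trans (any-allFin-suc (λ i → lookup (b ∷ F) i ∧ ⌊ f i Fin.≟ j ⌋))
    (cong ((b ∧ ⌊ f Fin.zero Fin.≟ j ⌋) ∨_) (sym (lookup-image (f ∘ Fin.suc) F j))))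

∑-image : ∀ {k n} {f : Fin k → Fin n} → Injective _≡_ _≡_ f → ∀ F →
          ∑ (allFin n) (𝟙 ∘ lookup (image f F)) ≡ fromℕ ∣ F ∣
∑-image {n = n} {f} inj [] = trans (∑-cong (allFin n) (λ j → cong 𝟙 (lookup-image f [] j))) (∑-zero (allFin n))
∑-image {n = n} {f} inj (b ∷ F) = begin
  ∑ 𝒩 (𝟙 ∘ lookup (image f (b ∷ F)))
    ≡⟨ ∑-cong 𝒩 (λ j → trans (cong 𝟙 (lookup-image-∷ f b F j)) (𝟙-∨-disjoint _ _ (disjoint j))) ⟩
  ∑ 𝒩 (λ j → 𝟙 (b ∧ ⌊ f Fin.zero Fin.≟ j ⌋) ℚ.+ 𝟙 (lookup (image f′ F) j))
    ≡⟨ ∑-+ 𝒩 (λ j → 𝟙 (b ∧ ⌊ f Fin.zero Fin.≟ j ⌋)) (𝟙 ∘ lookup (image f′ F)) ⟩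
  ∑ 𝒩 (λ j → 𝟙 (b ∧ ⌊ f Fin.zero Fin.≟ j ⌋)) ℚ.+ ∑ 𝒩 (𝟙 ∘ lookup (image f′ F))
    ≡⟨ cong₂ ℚ._+_ (∑-head b) (∑-image (FinP.suc-injective ∘ inj) F) ⟩
  𝟙 b ℚ.+ fromℕ ∣ F ∣
    ≡⟨ fromℕ-∣∷∣ b F ⟨
  fromℕ ∣ b ∷ F ∣ ∎
  where
  open ≡-Reasoning
  𝒩 = allFin n
  f′ = f ∘ Fin.suc
  disjoint : ∀ j → b ∧ ⌊ f Fin.zero Fin.≟ j ⌋ ≡ true → lookup (image f′ F) j ≡ true → ⊥
  disjoint j hit₀ hit with image-∋⁻ f′ F hit
  ... | i , _ , f′i≡j with () ← inj (trans f′i≡j (sym (⌊⌋≡true⇒ (f Fin.zero Fin.≟ j) (proj₂ (∧≡true {b} hit₀)))))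
  ∑-head : ∀ b → ∑ 𝒩 (λ j → 𝟙 (b ∧ ⌊ f Fin.zero Fin.≟ j ⌋)) ≡ 𝟙 b
  ∑-head true  = ∑-allFin-δ (f Fin.zero)
  ∑-head false = ∑-zero 𝒩

∣image∣ : ∀ {k n} {f : Fin k → Fin n} → Injective _≡_ _≡_ f → ∀ F → ∣ image f F ∣ ≡ ∣ F ∣
∣image∣ {f = f} inj F = fromℕ-injective (trans (fromℕ-∣∣ (image f F)) (∑-image inj F))

module _ {k m} (x : Fin (suc m)) (f : Fin k → Fin m) where

  extend : Fin (suc k) → Fin (suc m)
  extend Fin.zero    = x
  extend (Fin.suc i) = punchIn x (f i)

  extend-injective : Injective _≡_ _≡_ f → Injective _≡_ _≡_ extend
  extend-injective inj {Fin.zero}  {Fin.zero}  _  = refl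
  extend-injective inj {Fin.zero}  {Fin.suc j} eq = ⊥-elim (FinP.punchInᵢ≢i x (f j) (sym eq))
  extend-injective inj {Fin.suc i} {Fin.zero}  eq = ⊥-elim (FinP.punchInᵢ≢i x (f i) eq)
  extend-injective inj {Fin.suc i} {Fin.suc j} eq = cong Fin.suc (inj (FinP.punchIn-injective x (f i) (f j) eq))

  image-extend : ∀ F → image extend (true ∷ F) ≡ insertAt (image f F) x true
  image-extend F = ≗-lookup⇒≡ (λ j → ⇔→≡ {z = true} (mk⇔ (⇒insert j) (⇐insert j)))
    where
    InImage InInsert : Fin (suc m) → Set
    InImage  j = lookup (image extend (true ∷ F)) j ≡ true
    InInsert j = lookup (insertAt (image f F) x true) j ≡ true
    ⇒insert : ∀ j → InImage j → InInsert j
    ⇒insert j hit with image-∋⁻ extend (true ∷ F) {j} hit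
    ... | Fin.zero  , _  , refl = VecP.insertAt-lookup (image f F) x true
    ... | Fin.suc i , Fi , refl = trans (VecP.insertAt-punchIn (image f F) x true (f i)) (image-∋⁺ f F Fi)
    ⇐insert-punchIn : ∀ j → InInsert (punchIn x j) → InImage (punchIn x j)
    ⇐insert-punchIn j hit with image-∋⁻ f F (trans (sym (VecP.insertAt-punchIn (image f F) x true j)) hit)
    ... | i , Fi , refl = image-∋⁺ extend (true ∷ F) {Fin.suc i} Fi
    ⇐insert : ∀ j → InInsert j → InImage j
    ⇐insert j hit with x Fin.≟ j
    ... | yes refl = image-∋⁺ extend (true ∷ F) {Fin.zero} refl
    ... | no x≢j   = subst InImage (FinP.punchIn-punchOut x≢j)
                       (⇐insert-punchIn (punchOut x≢j) (subst InInsert (sym (FinP.punchIn-punchOut x≢j)) hit))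

h-levels : ∀ n (P : ℕ → Bool) → h (hg n (P ∘ ∣_∣)) ≡ ∑ (upTo (suc n)) (𝟙 ∘ P)
h-levels n P = begin
  ∑ (filterᵇ (P ∘ ∣_∣) (allSubsets n)) (λ F → inv (n C ∣ F ∣))
    ≡⟨ ∑-filterᵇ (P ∘ ∣_∣) (allSubsets n) (λ F → inv (n C ∣ F ∣)) ⟩
  ∑ (allSubsets n) (u ∘ ∣_∣)
    ≡⟨ ∑-by-size n u ⟩
  ∑ (upTo (suc n)) (λ j → fromℕ (n C j) ℚ.* u j)
    ≡⟨ ∑-upTo-cong (suc n) level ⟩
  ∑ (upTo (suc n)) (𝟙 ∘ P)
    ∎
  where
  open ≡-Reasoning
  u : ℕ → ℚ
  u j = inv (n C j) when P j
  level : ∀ j → j ℕ.< suc n → fromℕ (n C j) ℚ.* u j ≡ 𝟙 (P j)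
  level j (s≤s j≤n) = trans (*-when (fromℕ (n C j)) (inv (n C j)) (P j))
    (cong (_when P j) (fromℕ-C-*-inv-C j≤n))

-- Lower bound

allowedSize : (H : Hypergraph) → Subset (v H) → ℕ → Bool
allowedSize H E₀ j = hasSize (S H) j ∧ not (suc ∣ E₀ ∣ ≡ᵇ j)

allLevelsExcept : (H : Hypergraph) → Subset (v H) → ℕ → Hypergraph
allLevelsExcept H E₀ n = hg n (allowedSize H E₀ ∘ ∣_∣)

allLevelsExcept-admissible : ∀ H {E₀} → edge H E₀ ≡ true → ∀ n → Admissible (S H) n (allLevelsExcept H E₀ n)
allLevelsExcept-admissible H {E₀} E₀∈H n = refl , (λ F e → proj₁ (∧≡true e)) , no-copy
  where
  no-copy : S H ⊑ allLevelsExcept H E₀ n → ⊥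
  no-copy (f , inj , f-edges) with ∧≡true (f-edges (inside ∷ E₀) E₀∈H)
  ... | _ , size-allowed with () ← trans (sym (cong not (≡ᵇ-refl ∣ E₀ ∣)))
          (subst (λ s → not (suc ∣ E₀ ∣ ≡ᵇ s) ≡ true) (∣image∣ inj (inside ∷ E₀)) size-allowed)

h-allLevelsExcept : ∀ H {E₀} → edge H E₀ ≡ true → ∀ {n} → v H ℕ.< n →
                    h (allLevelsExcept H E₀ n) ≡ fromℕ (sizeR H) ℚ.- 1ℚ
h-allLevelsExcept H {E₀} E₀∈H {n} vH<n = begin
  h (allLevelsExcept H E₀ n)                          ≡⟨ h-levels n P ⟩
  ∑ 𝒥 (𝟙 ∘ P)                                         ≡⟨ //-rightDividesʳ 1ℚ _ ⟨
  (∑ 𝒥 (𝟙 ∘ P) ℚ.+ 1ℚ) ℚ.- 1ℚ                         ≡⟨ cong (ℚ._- 1ℚ) sizes ⟨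
  fromℕ (sizeR H) ℚ.- 1ℚ                              ∎
  where
  open ≡-Reasoning
  open GroupProperties ℚP.+-0-group using (//-rightDividesʳ)
  P = allowedSize H E₀
  k = suc ∣ E₀ ∣
  𝒥 = upTo (suc n)
  k∈R : hasSize (S H) k ≡ true
  k∈R = trans (hasSize-S-suc H ∣ E₀ ∣) (hasSize-edge H E₀∈H)
  beyond : ∀ j → suc (suc (v H)) ℕ.≤ j → 𝟙 (hasSize (S H) j) ≡ 0ℚ
  beyond j vSH<j with hasSize (S H) j in j∈R
  ... | false = refl
  ... | true  = ⊥-elim (ℕP.<⇒≱ vSH<j (hasSize-≤ (S H) j∈R))
  sizes : fromℕ (sizeR H) ≡ ∑ 𝒥 (𝟙 ∘ P) ℚ.+ 1ℚ
  sizes = begin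
    fromℕ (sizeR H)
      ≡⟨ fromℕ-sizeR-S H ⟨
    fromℕ (sizeR (S H))
      ≡⟨ fromℕ-sizeR (S H) ⟩
    ∑ (upTo (suc (suc (v H)))) (𝟙 ∘ hasSize (S H))
      ≡⟨ ∑-upTo-vanishing (𝟙 ∘ hasSize (S H)) (s≤s vH<n) beyond ⟨
    ∑ 𝒥 (𝟙 ∘ hasSize (S H))
      ≡⟨ ∑-cong 𝒥 (λ j → 𝟙-split (hasSize (S H) j) (k ≡ᵇ j)) ⟩
    ∑ 𝒥 (λ j → 𝟙 (P j) ℚ.+ 𝟙 (hasSize (S H) j) when (k ≡ᵇ j))
      ≡⟨ ∑-+ 𝒥 (𝟙 ∘ P) (λ j → 𝟙 (hasSize (S H) j) when (k ≡ᵇ j)) ⟩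
    ∑ 𝒥 (𝟙 ∘ P) ℚ.+ ∑ 𝒥 (λ j → 𝟙 (hasSize (S H) j) when (k ≡ᵇ j))
      ≡⟨ cong (∑ 𝒥 (𝟙 ∘ P) ℚ.+_) (∑-upTo-δ (s≤s (ℕP.≤-trans (s≤s (∣p∣≤n E₀)) vH<n)) (𝟙 ∘ hasSize (S H))) ⟩
    ∑ 𝒥 (𝟙 ∘ P) ℚ.+ 𝟙 (hasSize (S H) k)
      ≡⟨ cong (λ b → ∑ 𝒥 (𝟙 ∘ P) ℚ.+ 𝟙 b) k∈R ⟩
    ∑ 𝒥 (𝟙 ∘ P) ℚ.+ 1ℚ
      ∎

-- Upper bound via links

module _ {m : ℕ} (e : Subset (suc m) → Bool) where

  link : Fin (suc m) → Hypergraph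
  link x = hg m (λ F → e (insertAt F x true))

  -- An edge F through x contributes F ∖ {x}, of size ∣ F ∣ - 1, to the link of x.
  linkWeight : Subset (suc m) → ℚ
  linkWeight F = inv (m C ℕ.pred ∣ F ∣) when e F

  h-link : ∀ x → h (link x) ≡ ∑ (allSubsets (suc m)) (λ F → linkWeight F when lookup F x)
  h-link x = begin
    h (link x)
      ≡⟨ ∑-filterᵇ _ (allSubsets m) (λ F → inv (m C ∣ F ∣)) ⟩
    ∑ (allSubsets m) (λ F → inv (m C ∣ F ∣) when e (insertAt F x true))
      ≡⟨ ∑-cong (allSubsets m) (λ F → cong (λ s → inv (m C ℕ.pred s) when e (insertAt F x true)) (∣insertAt∣ F x)) ⟨
    ∑ (allSubsets m) (λ F → linkWeight (insertAt F x true))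
      ≡⟨ ∑-containing m x linkWeight ⟨
    ∑ (allSubsets (suc m)) (λ F → linkWeight F when lookup F x)
      ∎
    where open ≡-Reasoning

  ∑-h-link : (∀ F → e F ≡ true → 0 ℕ.< ∣ F ∣) → ∑ (allFin (suc m)) (h ∘ link) ≡ fromℕ (suc m) ℚ.* h (hg (suc m) e)
  ∑-h-link nonempty = begin
    ∑ 𝒳 (h ∘ link)
      ≡⟨ ∑-cong 𝒳 h-link ⟩
    ∑ 𝒳 (λ x → ∑ 𝒮 (λ F → linkWeight F when lookup F x))
      ≡⟨ ∑-swap 𝒳 𝒮 (λ x F → linkWeight F when lookup F x) ⟩
    ∑ 𝒮 (λ F → ∑ 𝒳 (λ x → linkWeight F when lookup F x))
      ≡⟨ ∑-cong 𝒮 (λ F → ∑-cong 𝒳 (λ x → when≡*𝟙 (linkWeight F) (lookup F x))) ⟩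
    ∑ 𝒮 (λ F → ∑ 𝒳 (λ x → linkWeight F ℚ.* 𝟙 (lookup F x)))
      ≡⟨ ∑-cong 𝒮 (λ F → ∑-*ˡ (linkWeight F) 𝒳 (𝟙 ∘ lookup F)) ⟨
    ∑ 𝒮 (λ F → linkWeight F ℚ.* ∑ 𝒳 (𝟙 ∘ lookup F))
      ≡⟨ ∑-cong 𝒮 (λ F → trans (ℚP.*-comm (fromℕ ∣ F ∣) (linkWeight F)) (cong (linkWeight F ℚ.*_) (fromℕ-∣∣ F))) ⟨
    ∑ 𝒮 (λ F → fromℕ ∣ F ∣ ℚ.* linkWeight F)
      ≡⟨ ∑-cong 𝒮 absorb ⟩
    ∑ 𝒮 (λ F → fromℕ (suc m) ℚ.* (inv (suc m C ∣ F ∣) when e F))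
      ≡⟨ ∑-*ˡ (fromℕ (suc m)) 𝒮 (λ F → inv (suc m C ∣ F ∣) when e F) ⟨
    fromℕ (suc m) ℚ.* ∑ 𝒮 (λ F → inv (suc m C ∣ F ∣) when e F)
      ≡⟨ cong (fromℕ (suc m) ℚ.*_) (∑-filterᵇ e 𝒮 (λ F → inv (suc m C ∣ F ∣))) ⟨
    fromℕ (suc m) ℚ.* h (hg (suc m) e)
      ∎
    where
    open ≡-Reasoning
    𝒳 = allFin (suc m)
    𝒮 = allSubsets (suc m)
    absorb-when : ∀ b s → (b ≡ true → 0 ℕ.< s) → s ℕ.≤ suc m →
                  fromℕ s ℚ.* (inv (m C ℕ.pred s) when b) ≡ fromℕ (suc m) ℚ.* (inv (suc m C s) when b)
    absorb-when false s       _   _         = trans (ℚP.*-zeroʳ (fromℕ s)) (sym (ℚP.*-zeroʳ (fromℕ (suc m))))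
    absorb-when true  (suc j) _   (s≤s j≤m) = C-absorb-inv j≤m
    absorb-when true  zero    0<0 _         with () ← 0<0 refl
    absorb : ∀ F → fromℕ ∣ F ∣ ℚ.* linkWeight F ≡ fromℕ (suc m) ℚ.* (inv (suc m C ∣ F ∣) when e F)
    absorb F = absorb-when (e F) ∣ F ∣ (nonempty F) (∣p∣≤n F)

  h-≤-links : (∀ F → e F ≡ true → 0 ℕ.< ∣ F ∣) → ∀ {q} → (∀ x → h (link x) ℚ.≤ q) → h (hg (suc m) e) ℚ.≤ q
  h-≤-links nonempty {q} links≤q = ℚP.*-cancelˡ-≤-pos (fromℕ (suc m)) {{ℚP.normalize-pos (suc m) 1}} (begin
    fromℕ (suc m) ℚ.* h (hg (suc m) e)     ≡⟨ ∑-h-link nonempty ⟨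
    ∑ (allFin (suc m)) (h ∘ link)          ≤⟨ ∑-mono-≤ (allFin (suc m)) links≤q ⟩
    ∑ (allFin (suc m)) (λ _ → q)           ≡⟨ ∑-const (allFin (suc m)) q ⟩
    fromℕ (length (allFin (suc m))) ℚ.* q  ≡⟨ cong (λ n → fromℕ n ℚ.* q) (ListP.length-tabulate {n = suc m} (λ i → i)) ⟩
    fromℕ (suc m) ℚ.* q                    ∎)
    where open ℚP.≤-Reasoning

  link-admissible : ∀ {H} → Admissible (S H) (suc m) (hg (suc m) e) → ∀ x → Admissible H m (link x)
  link-admissible {H} (_ , G⊆RSH , SH⋢G) x = refl , link⊆RH , H⋢link
    where
    link⊆RH : link x ⊆R H
    link⊆RH F eF = trans (sym (hasSize-S-suc H ∣ F ∣))
      (subst (λ s → hasSize (S H) s ≡ true) (∣insertAt∣ F x) (G⊆RSH (insertAt F x true) eF))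
    H⋢link : H ⊑ link x → ⊥
    H⋢link (f , inj , f-edges) = SH⋢G (extend x f , extend-injective x f inj , extend-edges)
      where
      extend-edges : ∀ F → edge (S H) F ≡ true → e (image (extend x f) F) ≡ true
      extend-edges (true ∷ F) eF = subst (λ F′ → e F′ ≡ true) (sym (image-extend x f F)) (f-edges F eF)
      extend-edges (false ∷ F) ()

π-S≤π : ∀ H {m q q′} → IsPi (S H) (suc m) q → IsPi H m q′ → q ℚ.≤ q′
π-S≤π H ((hg _ e , adm@(refl , G⊆RSH , _) , refl) , _) (_ , q′-max) =
  h-≤-links e (λ F eF → hasSize-S⇒positive H (G⊆RSH F eF)) (λ x → q′-max (link e x) (link-admissible e adm x))

-- Existence of π_m(H)

¬¬-argmax : ∀ (P : A → Set) (w : A → ℚ) xs {x₀} → P x₀ →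
            ¬ ¬ (Σ A λ b → P b × All.All (λ y → P y → w y ℚ.≤ w b) xs)
¬¬-argmax P w []       {x₀} Px₀ no-max = no-max (x₀ , Px₀ , All.[])
¬¬-argmax P w (y ∷ xs) Px₀ no-max = ¬¬-argmax P w xs Px₀ λ (b , Pb , b-max) →
  ¬¬-excluded-middle λ where
    (no ¬Py) → no-max (b , Pb , (λ Py → ⊥-elim (¬Py Py)) All.∷ b-max)
    (yes Py) → case w y ℚP.≤? w b of λ where
      (yes y≤b) → no-max (b , Pb , (λ _ → y≤b) All.∷ b-max)
      (no y≰b)  → let b≤y = ℚP.<⇒≤ (ℚP.≰⇒> y≰b) in
        no-max (y , Py , (λ _ → ℚP.≤-refl) All.∷ All.map (λ z≤b Pz → ℚP.≤-trans (z≤b Pz) b≤y) b-max)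

byHead : ∀ {m} → (Subset m → Bool) → (Subset m → Bool) → Subset (suc m) → Bool
byHead a b (true  ∷ F) = a F
byHead a b (false ∷ F) = b F

predicates : ∀ m → List (Subset m → Bool)
predicates zero    = (λ _ → true) ∷ (λ _ → false) ∷ []
predicates (suc m) = List.cartesianProductWith byHead (predicates m) (predicates m)

predicates-complete : ∀ m (e : Subset m → Bool) → ∃ λ e′ → e′ ∈ predicates m × (∀ F → e F ≡ e′ F)
predicates-complete zero e with e [] in e[]
... | true  = _ , here refl , λ { [] → e[] }
... | false = _ , there (here refl) , λ { [] → e[] }
predicates-complete (suc m) e with predicates-complete m (e ∘ (true ∷_)) | predicates-complete m (e ∘ (false ∷_))
... | a , a∈ , e≗a | b , b∈ , e≗b = byHead a b , ∈-cartesianProductWith⁺ byHead a∈ b∈ , e≗ab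
  where
  e≗ab : ∀ F → e F ≡ byHead a b F
  e≗ab (true  ∷ F) = e≗a F
  e≗ab (false ∷ F) = e≗b F

Admissible-≗ : ∀ {H m} {e e′ : Subset m → Bool} → (∀ F → e F ≡ e′ F) →
               Admissible H m (hg m e) → Admissible H m (hg m e′)
Admissible-≗ e≗e′ (refl , e⊆RH , H⋢e) =
  refl , (λ F e′F → e⊆RH F (trans (e≗e′ F) e′F)) ,
  λ (f , inj , f-edges) → H⋢e (f , inj , λ F eF → trans (e≗e′ (image f F)) (f-edges F eF))

h-≗ : ∀ {m} {e e′ : Subset m → Bool} → (∀ F → e F ≡ e′ F) → h (hg m e) ≡ h (hg m e′)
h-≗ {m} {e} {e′} e≗e′ = begin
  h (hg m e)                            ≡⟨ ∑-filterᵇ e 𝒮 w ⟩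
  ∑ 𝒮 (λ F → w F when e F)              ≡⟨ ∑-cong 𝒮 (λ F → cong (w F when_) (e≗e′ F)) ⟩
  ∑ 𝒮 (λ F → w F when e′ F)             ≡⟨ ∑-filterᵇ e′ 𝒮 w ⟨
  h (hg m e′)                           ∎
  where
  open ≡-Reasoning
  𝒮 = allSubsets m
  w : Subset m → ℚ
  w F = inv (m C ∣ F ∣)

π-exists : ∀ H {E₀} → edge H E₀ ≡ true → ∀ m → ¬ ¬ Σ ℚ (IsPi H m)
π-exists H {E₀} E₀∈H m =
  ¬¬-map maximum (¬¬-argmax (Admissible H m ∘ hg m) (h ∘ hg m) (predicates m) edgeless-admissible)
  where
  edgeless-admissible : Admissible H m (hg m (λ _ → false))
  edgeless-admissible = refl , (λ F ()) , λ (f , _ , f-edges) → case f-edges E₀ E₀∈H of λ ()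
  maximum : (Σ _ λ b → Admissible H m (hg m b) ×
              All.All (λ e → Admissible H m (hg m e) → h (hg m e) ℚ.≤ h (hg m b)) (predicates m)) →
            Σ ℚ (IsPi H m)
  maximum (b , b-admissible , b-max) = h (hg m b) , (hg m b , b-admissible , refl) , bound
    where
    bound : (G : Hypergraph) → Admissible H m G → h G ℚ.≤ h (hg m b)
    bound (hg _ e) adm@(refl , _) with predicates-complete m e
    ... | e′ , e′∈ , e≗e′ = subst (ℚ._≤ h (hg m b)) (sym (h-≗ e≗e′)) (All.lookup b-max e′∈ (Admissible-≗ e≗e′ adm))

squeeze : ∀ {t q q′ ε : ℚ} → t ℚ.≤ q → q ℚ.≤ q′ → ℚ.∣ q′ ℚ.- t ∣ ℚ.< ε → ℚ.∣ q ℚ.- t ∣ ℚ.< ε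
squeeze {t} {q} {q′} t≤q q≤q′ = ℚP.≤-<-trans (subst₂ ℚ._≤_ (sym (∣∣≡ t≤q)) (sym (∣∣≡ (ℚP.≤-trans t≤q q≤q′)))
  (ℚP.+-monoˡ-≤ (ℚ.- t) q≤q′))
  where
  ∣∣≡ : ∀ {r} → t ℚ.≤ r → ℚ.∣ r ℚ.- t ∣ ≡ r ℚ.- t
  ∣∣≡ {r} t≤r = ℚP.0≤p⇒∣p∣≡p (subst (ℚ._≤ r ℚ.- t) (ℚP.+-inverseʳ t) (ℚP.+-monoˡ-≤ (ℚ.- t) t≤r))

edge-or-edgeless : ∀ G → (∃ λ F → edge G F ≡ true) ⊎ (∀ F → edge G F ≡ false)
edge-or-edgeless G with edges G in edges-eq
... | E₀ ∷ _ = inj₁ (E₀ , Equivalence.to T-≡ (proj₂ (∈-filter⁻ (T? ∘ edge G) {xs = allSubsets (v G)} E₀∈edges)))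
  where
  E₀∈edges : E₀ ∈ edges G
  E₀∈edges = subst (E₀ ∈_) (sym edges-eq) (here refl)
... | []     = inj₂ edgeless
  where
  edgeless : ∀ F → edge G F ≡ false
  edgeless F with edge G F in eF
  ... | false = refl
  ... | true with () ← subst (F ∈_) edges-eq (∈-edges G eF)

S-edgeless-⊑ : ∀ H G → (∀ F → edge H F ≡ false) → suc (v H) ℕ.≤ v G → S H ⊑ G
S-edgeless-⊑ H G edgeless vSH≤vG =
  (λ i → Fin.inject≤ i vSH≤vG) , (λ {i} {j} → FinP.inject≤-injective vSH≤vG vSH≤vG i j) , no-edges
  where
  no-edges : ∀ F → edge (S H) F ≡ true → edge G (image (λ i → Fin.inject≤ i vSH≤vG) F) ≡ true
  no-edges (true ∷ F) eF with () ← trans (sym (edgeless F)) eF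

π-S-between : ∀ H {E₀} → edge H E₀ ≡ true → ∀ {m q q′} → v H ℕ.≤ m → IsPi (S H) (suc m) q → IsPi H m q′ →
              fromℕ (sizeR H) ℚ.- 1ℚ ℚ.≤ q × q ℚ.≤ q′
π-S-between H {E₀} E₀∈H {m} vH≤m πq πq′ =
  subst (ℚ._≤ _) (h-allLevelsExcept H E₀∈H (s≤s vH≤m))
    (proj₂ πq (allLevelsExcept H E₀ (suc m)) (allLevelsExcept-admissible H E₀∈H (suc m))) ,
  π-S≤π H πq πq′

edgeless⇒S-degenerate : ∀ H → (∀ F → edge H F ≡ false) → Degenerate (S H)
edgeless⇒S-degenerate H edgeless ε _ = suc (v H) , λ where
  n vSH≤n q ((G , (refl , _ , SH⋢G) , _) , _) → ⊥-elim (SH⋢G (S-edgeless-⊑ H G edgeless vSH≤n))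

degenerate⇒S-degenerate : ∀ H {E₀} → edge H E₀ ≡ true → Degenerate H → Degenerate (S H)
degenerate⇒S-degenerate H E₀∈H degH ε ε>0 = suc (N ℕ.+ v H) , close
  where
  N = proj₁ (degH ε ε>0)
  t = fromℕ (sizeR H) ℚ.- 1ℚ
  close : ∀ n → suc (N ℕ.+ v H) ℕ.≤ n → ∀ q → IsPi (S H) n q → ℚ.∣ q ℚ.- (fromℕ (sizeR (S H)) ℚ.- 1ℚ) ∣ ℚ.< ε
  close (suc m) (s≤s N+vH≤m) q πq = subst (λ r → ℚ.∣ q ℚ.- (r ℚ.- 1ℚ) ∣ ℚ.< ε) (sym (fromℕ-sizeR-S H))
    (decidable-stable (ℚ.∣ q ℚ.- t ∣ ℚP.<? ε) λ q-far → π-exists H E₀∈H m λ (q′ , πq′) →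
      let t≤q , q≤q′ = π-S-between H E₀∈H (ℕP.≤-trans (ℕP.m≤n+m (v H) N) N+vH≤m) πq πq′ in
      q-far (squeeze t≤q q≤q′ (proj₂ (degH ε ε>0) m (ℕP.≤-trans (ℕP.m≤m+n N (v H)) N+vH≤m) q′ πq′)))

mainTheorem18 : (H : Hypergraph) → Degenerate H → Degenerate (S H)
mainTheorem18 H degH = case edge-or-edgeless H of λ where
  (inj₁ (_ , E₀∈H)) → degenerate⇒S-degenerate H E₀∈H degH
  (inj₂ edgeless)   → edgeless⇒S-degenerate H edgeless
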